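{- Let $f: A^*\to B^*$ be a non-erasing morphism and $q$ a non-empty word over $B$. For an infinite word $\mathbf{w}$ over $A$, the infinite word $f(\mathbf{w})$ is $q$-quasiperiodic if and only if every finite prefix of $\mathbf{w}$ is recognized by the automaton $\mathcal{A}'_q(f)$.
   Context: For a non-empty word $q$, a finite word $w$ is $q$-quasiperiodic if $w\neq q$ and every position of $w$ lies within some occurrence of $q$ in $w$; an infinite word is $q$-quasiperiodic if every position lies within some occurrence of $q$. The automaton $\mathcal{A}'_q(f) = (A,Q,i,Q,\Delta)$ has: states $Q$ the pairs $(p,s)$ of words with $ps$ a proper prefix of $q$; initial state $(\varepsilon,\varepsilon)$; all states final; transitions the triples $((p_1,s_1),a,(p_2,s_2))$ with $(p_1,s_1),(p_2,s_2)\in Q$, $a\in A$, such that either (1) $q$ does not occur in $p_1s_1f(a)$, $|q|>|s_1f(a)|$, $s_2=s_1f(a)$, and $p_2$ is the longest suffix of $p_1$ such that $p_2s_1f(a)$ is a proper prefix of $q$; or (2) $q$ occurs in $p_1s_1f(a)$, there exist a suffix $x$ of $p_1$ and a word $y$ with $xs_1f(a)=ys_2$ where $y=q$ or $y$ is $q$-quasiperiodic, and $p_2$ is the longest suffix of $y$ such that $p_2s_2$ is a proper prefix of $q$. A finite word is recognized if there is a path labelled by it from the initial state (to some state, all being final). -}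

module Defs where

open import Data.Nat using (ℕ; zero; suc; _+_; _≤_; _<_)
open import Data.Fin using (Fin)
open import Data.List using (List; []; _∷_; _++_; length; map; upTo)
open import Data.Product using (Σ; ∃; ∃-syntax; _×_; _,_)
open import Data.Sum using (_⊎_)
open import Data.Empty using (⊥-elim)
open import Relation.Nullary using (¬_)
open import Relation.Binary.PropositionalEquality using (_≡_; _≢_; refl)

Occurs : ∀ {B : Set} → List B → List B → Set
Occurs {B} q u = ∃[ x ] ∃[ y ] (u ≡ x ++ q ++ y)

OccAt : ∀ {B : Set} → List B → List B → ℕ → Set
OccAt {B} q w j = ∃[ x ] ∃[ y ] (w ≡ x ++ q ++ y × length x ≡ j)

QP : ∀ {B : Set} → List B → List B → Set
QP q w = (w ≢ q) × (∀ i → i < length w →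
           ∃[ j ] (OccAt q w j × j ≤ i × i < j + length q))

OccAtInf : ∀ {B : Set} → List B → (ℕ → B) → ℕ → Set
OccAtInf q x j = map (λ t → x (j + t)) (upTo (length q)) ≡ q

QPInf : ∀ {B : Set} → List B → (ℕ → B) → Set
QPInf q x = ∀ i → ∃[ j ] (OccAtInf q x j × j ≤ i × i < j + length q)

prefix : ∀ {A : Set} → ℕ → (ℕ → A) → List A
prefix n w = map w (upTo n)

ProperPrefix : ∀ {B : Set} → List B → List B → Set
ProperPrefix u q = ∃[ v ] (v ≢ [] × u ++ v ≡ q)

Suffix : ∀ {B : Set} → List B → List B → Set
Suffix x p = ∃[ z ] (z ++ x ≡ p)

headOf : ∀ {B : Set} (u : List B) → u ≢ [] → B
headOf [] p = ⊥-elim (p refl)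
headOf (b ∷ _) _ = b

module Image {A B : Set} (f : A → List B) (ne : ∀ a → f a ≢ []) (w : ℕ → A) where
  -- img fuel k i : the letter at offset i of f(w k) f(w (k+1)) ...
  img : ℕ → ℕ → ℕ → B
  walk : ℕ → ℕ → List B → ℕ → B
  img zero k i = headOf (f (w k)) (ne (w k))   -- unreachable default (fuel suffices)
  img (suc fuel) k i = walk fuel k (f (w k)) i
  walk fuel k [] i = img fuel (suc k) i
  walk fuel k (b ∷ u) zero = b
  walk fuel k (b ∷ u) (suc i) = walk fuel k u i

  -- f(w) as an infinite word (each block has length ≥ 1, so fuel i+1 suffices)
  fw : ℕ → B
  fw i = img (suc i) 0 i

image : ∀ {A B : Set} (f : A → List B) → (∀ a → f a ≢ []) → (ℕ → A) → ℕ → B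
image f ne w = Image.fw f ne w

module Automaton {A B : Set} (f : A → List B) (q : List B) where
  State : Set
  State = List B × List B

  InQ : State → Set
  InQ (p , s) = ProperPrefix (p ++ s) q

  LongestSuffix : List B → List B → List B → Set
  LongestSuffix p2 p1 t =
    Suffix p2 p1 × ProperPrefix (p2 ++ t) q ×
    (∀ p' → Suffix p' p1 → ProperPrefix (p' ++ t) q → length p' ≤ length p2)

  Case1 : State → A → State → Set
  Case1 (p1 , s1) a (p2 , s2) =
    ¬ Occurs q (p1 ++ s1 ++ f a) ×
    length (s1 ++ f a) < length q ×
    s2 ≡ s1 ++ f a ×
    LongestSuffix p2 p1 (s1 ++ f a)

  Case2 : State → A → State → Set
  Case2 (p1 , s1) a (p2 , s2) =
    Occurs q (p1 ++ s1 ++ f a) ×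
    ∃[ x ] ∃[ y ] (Suffix x p1 × x ++ s1 ++ f a ≡ y ++ s2 ×
                   (y ≡ q ⊎ QP q y) × LongestSuffix p2 y s2)

  Trans : State → A → State → Set
  Trans st a st' = InQ st × InQ st' × (Case1 st a st' ⊎ Case2 st a st')

  -- there is a path labelled u starting from st (all states are final)
  Run : State → List A → Set
  Run st [] = InQ st
  Run st (a ∷ u) = ∃[ st' ] (Trans st a st' × Run st' u)

  initial : State
  initial = ([] , [])

  Recognized : List A → Set
  Recognized u = Run initial u

Recognized : ∀ {A B : Set} → (A → List B) → List B → List A → Set
Recognized f q = Automaton.Recognized f q

-- Write W = f(w) and let N be the length of the image of the prefix read so far.  Every
-- run of 𝒜'_q(f) keeps the invariant that its state (p, s) has s = W[c, N) and p a suffix of W[0, c)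
-- for some c ≤ N below which every position of W is covered by an occurrence of q: a transition of
-- type (2) moves c to the end of a factor W[e, c') that is q or q-quasiperiodic.  As |ps| < |q| and
-- N is at least the number of letters read, reading n + |q| letters covers position n of W.
-- Conversely, if W is q-quasiperiodic, take for each N the state (W[d, c), W[c, N)), where c is the
-- end of the last occurrence of q inside W[0, N) (or 0) and d ≤ c is least with W[d, N) a proper
-- prefix of q.  Consecutive such states are joined by a transition of type (1) when c stays put and
-- of type (2) when c grows; then the x and y of the transition start at the occurrence covering the
-- old c, and y is q or q-quasiperiodic because it is covered by occurrences lying inside it.

module Submission where

open import Defs
open import Data.Nat using (ℕ; zero; suc; _+_; _∸_; _≤_; _<_; z≤n; s≤s; _≤?_; _<?_)
open import Data.Fin using (Fin)
import Data.Fin.Properties as Fin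
open import Data.Nat.Properties
open import Data.List using (List; []; _∷_; _++_; length; map; upTo; applyUpTo)
open import Data.List.Properties
  using (length-++; ++-assoc; ++-conicalʳ; ≡-dec; ∷-injectiveˡ; ∷-injectiveʳ; map-applyUpTo)
open import Data.Product using (∃; ∃-syntax; _×_; _,_; proj₁; proj₂)
open import Data.Sum using (_⊎_; inj₁; inj₂)
open import Data.Empty using (⊥; ⊥-elim)
open import Function using (_∘_; id)
open import Function.Bundles using (_⇔_; mk⇔)
open import Relation.Nullary using (¬_; Dec; yes; no)
open import Relation.Nullary.Decidable using (_×-dec_)
open import Relation.Unary using (Decidable)
open import Relation.Binary.Definitions using (DecidableEquality)
open import Relation.Binary.PropositionalEquality

module _ {B : Set} where

  ++-injective-≡length : ∀ (xs ys : List B) {zs ws : List B} →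
    length xs ≡ length ys → xs ++ zs ≡ ys ++ ws → xs ≡ ys × zs ≡ ws
  ++-injective-≡length []       []       _   eq = refl , eq
  ++-injective-≡length (x ∷ xs) (y ∷ ys) len eq
    with ++-injective-≡length xs ys (suc-injective len) (∷-injectiveʳ eq)
  ... | refl , zs≡ws = cong (_∷ xs) (∷-injectiveˡ eq) , zs≡ws

  ≢[]⇒length>0 : ∀ {xs : List B} → xs ≢ [] → 0 < length xs
  ≢[]⇒length>0 {[]}    xs≢[] = ⊥-elim (xs≢[] refl)
  ≢[]⇒length>0 {_ ∷ _} _     = s≤s z≤n

  length>0⇒≢[] : ∀ {xs : List B} → 0 < length xs → xs ≢ []
  length>0⇒≢[] {_ ∷ _} _ ()

  Suffix-trans : ∀ {xs ys zs : List B} → Suffix xs ys → Suffix ys zs → Suffix xs zs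
  Suffix-trans {xs} (u , refl) (v , refl) = v ++ u , ++-assoc v u xs

  ProperPrefix⇒length< : ∀ {xs ys : List B} → ProperPrefix xs ys → length xs < length ys
  ProperPrefix⇒length< {xs} (v , v≢[] , refl) = begin-strict
    length xs             ≡⟨ +-identityʳ (length xs) ⟨
    length xs + 0         <⟨ +-monoʳ-< (length xs) (≢[]⇒length>0 v≢[]) ⟩
    length xs + length v  ≡⟨ length-++ xs ⟨
    length (xs ++ v)      ∎
    where open ≤-Reasoning

  ProperPrefix-++⁻ : ∀ {xs ys zs : List B} → ProperPrefix (xs ++ ys) zs → ProperPrefix xs zs
  ProperPrefix-++⁻ {xs} {ys} (v , v≢[] , refl) =
    ys ++ v , v≢[] ∘ ++-conicalʳ ys v , sym (++-assoc xs ys v)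

  properPrefix? : DecidableEquality B → (xs ys : List B) → Dec (ProperPrefix xs ys)
  properPrefix? _≟_ []       []       = no λ { (v , v≢[] , v≡[]) → v≢[] v≡[] }
  properPrefix? _≟_ []       (y ∷ ys) = yes (y ∷ ys , (λ ()) , refl)
  properPrefix? _≟_ (x ∷ xs) []       = no λ { (_ , _ , ()) }
  properPrefix? _≟_ (x ∷ xs) (y ∷ ys) with x ≟ y | properPrefix? _≟_ xs ys
  ... | no x≢y   | _   = no λ { (_ , _ , eq) → x≢y (∷-injectiveˡ eq) }
  ... | yes refl | yes (v , v≢[] , eq) = yes (v , v≢[] , cong (x ∷_) eq)
  ... | yes refl | no ¬pp = no λ { (v , v≢[] , eq) → ¬pp (v , v≢[] , ∷-injectiveʳ eq) }

firstUpTo : ∀ {P : ℕ → Set} → Decidable P → ℕ → ℕ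
firstUpTo P? zero = zero
firstUpTo P? (suc n) with P? zero
... | yes _ = zero
... | no  _ = suc (firstUpTo (P? ∘ suc) n)

firstUpTo-≤ : ∀ {P : ℕ → Set} (P? : Decidable P) n → firstUpTo P? n ≤ n
firstUpTo-≤ P? zero = z≤n
firstUpTo-≤ P? (suc n) with P? zero
... | yes _ = z≤n
... | no  _ = s≤s (firstUpTo-≤ (P? ∘ suc) n)

firstUpTo-least : ∀ {P : ℕ → Set} (P? : Decidable P) {m n} → m ≤ n → P m →
                  P (firstUpTo P? n) × firstUpTo P? n ≤ m
firstUpTo-least P? {n = zero} z≤n Pm = Pm , z≤n
firstUpTo-least P? {m} {suc n} m≤n Pm with P? zero
... | yes P0 = P0 , z≤n
firstUpTo-least P? {zero}  {suc n} _         P0 | no ¬P0 = ⊥-elim (¬P0 P0)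
firstUpTo-least P? {suc m} {suc n} (s≤s m≤n) Pm | no _ =
  let Pfirst , first≤m = firstUpTo-least (P? ∘ suc) m≤n Pm in Pfirst , s≤s first≤m

lastUpTo : ∀ {P : ℕ → Set} → Decidable P → ℕ → ℕ
lastUpTo P? zero = zero
lastUpTo P? (suc n) with P? (suc n)
... | yes _ = suc n
... | no  _ = lastUpTo P? n

lastUpTo-≤ : ∀ {P : ℕ → Set} (P? : Decidable P) n → lastUpTo P? n ≤ n
lastUpTo-≤ P? zero = z≤n
lastUpTo-≤ P? (suc n) with P? (suc n)
... | yes _ = ≤-refl
... | no  _ = m≤n⇒m≤1+n (lastUpTo-≤ P? n)

lastUpTo-zero-or-satisfies : ∀ {P : ℕ → Set} (P? : Decidable P) n →
                             lastUpTo P? n ≡ 0 ⊎ P (lastUpTo P? n)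
lastUpTo-zero-or-satisfies P? zero = inj₁ refl
lastUpTo-zero-or-satisfies P? (suc n) with P? (suc n)
... | yes Pn = inj₂ Pn
... | no  _  = lastUpTo-zero-or-satisfies P? n

lastUpTo-greatest : ∀ {P : ℕ → Set} (P? : Decidable P) {m n} → m ≤ n → P m → m ≤ lastUpTo P? n
lastUpTo-greatest P? {n = zero} z≤n _ = z≤n
lastUpTo-greatest P? {m} {suc n} m≤n Pm with P? (suc n)
... | yes _ = m≤n
... | no ¬Pn with m≤n⇒m<n∨m≡n m≤n
...   | inj₁ (s≤s m≤n') = lastUpTo-greatest P? m≤n' Pm
...   | inj₂ refl       = ⊥-elim (¬Pn Pm)

lastUpTo-mono : ∀ {P : ℕ → Set} (P? : Decidable P) {m n} → m ≤ n → lastUpTo P? m ≤ lastUpTo P? n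
lastUpTo-mono P? {m} m≤n with lastUpTo P? m | lastUpTo-≤ P? m | lastUpTo-zero-or-satisfies P? m
... | _ | _      | inj₁ refl = z≤n
... | l | l≤m    | inj₂ Pl   = lastUpTo-greatest P? (≤-trans l≤m m≤n) Pl

module Window {B : Set} (W : ℕ → B) where

  window : ℕ → ℕ → List B
  window a zero    = []
  window a (suc m) = W a ∷ window (suc a) m

  -- W[a, b); truncated subtraction makes it empty when b ≤ a.
  slice : ℕ → ℕ → List B
  slice a b = window a (b ∸ a)

  length-window : ∀ a m → length (window a m) ≡ m
  length-window a zero    = refl
  length-window a (suc m) = cong suc (length-window (suc a) m)

  window-++ : ∀ a m n → window a (m + n) ≡ window a m ++ window (a + m) n
  window-++ a zero    n = cong (λ b → window b n) (sym (+-identityʳ a))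
  window-++ a (suc m) n = cong (W a ∷_) (begin
    window (suc a) (m + n)
      ≡⟨ window-++ (suc a) m n ⟩
    window (suc a) m ++ window (suc a + m) n
      ≡⟨ cong (λ b → window (suc a) m ++ window b n) (+-suc a m) ⟨
    window (suc a) m ++ window (a + suc m) n ∎)
    where open ≡-Reasoning

  window-++⁻ : ∀ a (xs ys : List B) → xs ++ ys ≡ window a (length xs + length ys) →
               xs ≡ window a (length xs) × ys ≡ window (a + length xs) (length ys)
  window-++⁻ a xs ys eq = ++-injective-≡length xs _ (sym (length-window a (length xs)))
                                                  (trans eq (window-++ a (length xs) (length ys)))

  applyUpTo-window : ∀ (g : ℕ → B) a m → (∀ t → t < m → g t ≡ W (a + t)) →
                     applyUpTo g m ≡ window a m
  applyUpTo-window g a zero    g≗W = refl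
  applyUpTo-window g a (suc m) g≗W = cong₂ _∷_
    (trans (g≗W 0 (s≤s z≤n)) (cong W (+-identityʳ a)))
    (applyUpTo-window (g ∘ suc) (suc a) m
      (λ t t<m → trans (g≗W (suc t) (s≤s t<m)) (cong W (+-suc a t))))

  length-slice : ∀ a b → length (slice a b) ≡ b ∸ a
  length-slice a b = length-window a (b ∸ a)

  slice-window : ∀ a m → slice a (a + m) ≡ window a m
  slice-window a m = cong (window a) (m+n∸m≡n a m)

  slice-empty : ∀ a → slice a a ≡ []
  slice-empty a = cong (window a) (n∸n≡0 a)

  slice-++ : ∀ {a b c} → a ≤ b → b ≤ c → slice a b ++ slice b c ≡ slice a c
  slice-++ {a} {b} {c} a≤b b≤c = begin
    window a (b ∸ a) ++ window b (c ∸ b)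
      ≡⟨ cong (λ x → window a (b ∸ a) ++ window x (c ∸ b)) (m+[n∸m]≡n a≤b) ⟨
    window a (b ∸ a) ++ window (a + (b ∸ a)) (c ∸ b)
      ≡⟨ window-++ a (b ∸ a) (c ∸ b) ⟨
    window a ((b ∸ a) + (c ∸ b))
      ≡⟨ cong (window a) (+-comm (b ∸ a) (c ∸ b)) ⟩
    window a ((c ∸ b) + (b ∸ a))
      ≡⟨ cong (window a) (+-∸-assoc (c ∸ b) a≤b) ⟨
    window a ((c ∸ b + b) ∸ a)
      ≡⟨ cong (λ x → window a (x ∸ a)) (m∸n+n≡m b≤c) ⟩
    window a (c ∸ a) ∎
    where open ≡-Reasoning

  map-upTo≡window : ∀ a m → map (λ t → W (a + t)) (upTo m) ≡ window a m
  map-upTo≡window a m = trans (map-applyUpTo id _ m) (applyUpTo-window _ a m (λ _ _ → refl))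

  length-slice-antitone : ∀ {d e c} → d ≤ e → length (slice e c) ≤ length (slice d c)
  length-slice-antitone {d} {e} {c} d≤e =
    subst₂ _≤_ (sym (length-slice e c)) (sym (length-slice d c)) (∸-monoʳ-≤ c d≤e)

  Suffix-slice : ∀ {a e b} → a ≤ e → e ≤ b → Suffix (slice e b) (slice a b)
  Suffix-slice a≤e e≤b = _ , slice-++ a≤e e≤b

  slice-++⁻ : ∀ {a b} (xs ys : List B) → xs ++ ys ≡ slice a b → a ≤ b →
              a + length xs ≤ b × xs ≡ window a (length xs) × ys ≡ slice (a + length xs) b
  slice-++⁻ {a} {b} xs ys eq a≤b = e≤b , proj₁ split , trans (proj₂ split) (sym ys-slice)
    where
    e : ℕ
    e = a + length xs
    lengths : length xs + length ys ≡ b ∸ a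
    lengths = trans (sym (length-++ xs)) (trans (cong length eq) (length-slice a b))
    b≡ : e + length ys ≡ b
    b≡ = trans (+-assoc a _ _) (trans (cong (a +_) lengths) (m+[n∸m]≡n a≤b))
    e≤b : e ≤ b
    e≤b = subst (e ≤_) b≡ (m≤m+n e _)
    split : xs ≡ window a (length xs) × ys ≡ window e (length ys)
    split = window-++⁻ a xs ys (trans eq (cong (window a) (sym lengths)))
    ys-slice : slice e b ≡ window e (length ys)
    ys-slice = trans (cong (slice e) (sym b≡)) (slice-window e (length ys))

  Suffix-slice⁻ : ∀ {a b} {xs : List B} → Suffix xs (slice a b) → a ≤ b →
                  ∃[ e ] (a ≤ e × e ≤ b × xs ≡ slice e b)
  Suffix-slice⁻ {a} {xs = xs} (zs , eq) a≤b =
    let e≤b , _ , xs≡ = slice-++⁻ zs xs eq a≤b in a + length zs , m≤m+n a _ , e≤b , xs≡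

module Occurrences {B : Set} (W : ℕ → B) (q : List B) where
  open Window W

  Q : ℕ
  Q = length q

  Occ : ℕ → Set
  Occ j = window j Q ≡ q

  Covers : ℕ → ℕ → Set
  Covers j i = Occ j × j ≤ i × i < j + Q

  CoveredBelow : ℕ → Set
  CoveredBelow c = ∀ i → i < c → ∃[ j ] Covers j i

  CoveredWithin : ℕ → Set
  CoveredWithin c = ∀ i → i < c → ∃[ j ] (Covers j i × j + Q ≤ c)

  OccAtInf⇒Occ : ∀ {j} → OccAtInf q W j → Occ j
  OccAtInf⇒Occ {j} = trans (sym (map-upTo≡window j Q))

  Occ⇒OccAtInf : ∀ {j} → Occ j → OccAtInf q W j
  Occ⇒OccAtInf {j} = trans (map-upTo≡window j Q)

  Occ-window : ∀ a m (xs ys : List B) → window a m ≡ xs ++ q ++ ys → Occ (a + length xs)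
  Occ-window a m xs ys eq = proj₁ (++-injective-≡length _ q (length-window _ Q) rest)
    where
    j : ℕ
    j = a + length xs
    m≡ : m ≡ length xs + (Q + length ys)
    m≡ = trans (sym (length-window a m))
               (trans (cong length eq) (trans (length-++ xs) (cong (length xs +_) (length-++ q))))
    split : window a (length xs) ++ window j Q ++ window (j + Q) (length ys) ≡ xs ++ q ++ ys
    split = trans (cong (window a (length xs) ++_) (sym (window-++ j Q (length ys))))
                  (trans (sym (window-++ a (length xs) _)) (trans (cong (window a) (sym m≡)) eq))
    rest : window j Q ++ window (j + Q) (length ys) ≡ q ++ ys
    rest = proj₂ (++-injective-≡length (window a (length xs)) xs (length-window a _) split)

  Occurs-slice⁻ : ∀ {a b} → Occurs q (slice a b) → a ≤ b → ∃[ j ] (Occ j × a ≤ j × j + Q ≤ b)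
  Occurs-slice⁻ {a} {b} (xs , ys , eq) a≤b =
    a + length xs , Occ-window a (b ∸ a) xs ys eq , m≤m+n a _ , j+Q≤b
    where
    lengths : b ∸ a ≡ length xs + (Q + length ys)
    lengths = trans (sym (length-slice a b))
                    (trans (cong length eq) (trans (length-++ xs) (cong (length xs +_) (length-++ q))))
    j+Q≤b : a + length xs + Q ≤ b
    j+Q≤b = begin
      a + length xs + Q                 ≡⟨ +-assoc a (length xs) Q ⟩
      a + (length xs + Q)               ≤⟨ +-monoʳ-≤ a (+-monoʳ-≤ (length xs) (m≤m+n Q (length ys))) ⟩
      a + (length xs + (Q + length ys)) ≡⟨ cong (a +_) lengths ⟨
      a + (b ∸ a)                       ≡⟨ m+[n∸m]≡n a≤b ⟩
      b                                 ∎
      where open ≤-Reasoning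

  OccAt-slice : ∀ {j a b} → Occ j → a ≤ j → j + Q ≤ b → OccAt q (slice a b) (j ∸ a)
  OccAt-slice {j} {a} {b} occ a≤j j+Q≤b =
    slice a j , slice (j + Q) b , sym decomposition , length-slice a j
    where
    decomposition : slice a j ++ q ++ slice (j + Q) b ≡ slice a b
    decomposition = begin
      slice a j ++ q ++ slice (j + Q) b
        ≡⟨ cong (λ u → slice a j ++ u ++ slice (j + Q) b) (trans (slice-window j Q) occ) ⟨
      slice a j ++ slice j (j + Q) ++ slice (j + Q) b
        ≡⟨ cong (slice a j ++_) (slice-++ (m≤m+n j Q) j+Q≤b) ⟩
      slice a j ++ slice j b
        ≡⟨ slice-++ a≤j (≤-trans (m≤m+n j Q) j+Q≤b) ⟩
      slice a b ∎
      where open ≡-Reasoning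

  Occurs-slice : ∀ {j a b} → Occ j → a ≤ j → j + Q ≤ b → Occurs q (slice a b)
  Occurs-slice occ a≤j j+Q≤b = let xs , ys , eq , _ = OccAt-slice occ a≤j j+Q≤b in xs , ys , eq

  Occ⇒ProperPrefix-slice : ∀ {j N} → Occ j → j ≤ N → N < j + Q → ProperPrefix (slice j N) q
  Occ⇒ProperPrefix-slice {j} {N} occ j≤N N<j+Q =
    slice N (j + Q) ,
    length>0⇒≢[] (subst (0 <_) (sym (length-slice N (j + Q))) (m<n⇒0<n∸m N<j+Q)) ,
    trans (slice-++ j≤N (<⇒≤ N<j+Q)) (trans (slice-window j Q) occ)

  ProperPrefix-slice⇒¬Occ : ∀ {d N j} → ProperPrefix (slice d N) q → Occ j → d ≤ j → j + Q ≤ N → ⊥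
  ProperPrefix-slice⇒¬Occ {d} {N} {j} pp _ d≤j j+Q≤N = <⇒≱ (ProperPrefix⇒length< pp) Q≤length
    where
    Q≤length : Q ≤ length (slice d N)
    Q≤length = subst (Q ≤_) (sym (length-slice d N)) (m+n≤o⇒m≤o∸n Q (begin
      Q + d ≡⟨ +-comm Q d ⟩
      d + Q ≤⟨ +-monoˡ-≤ Q d≤j ⟩
      j + Q ≤⟨ j+Q≤N ⟩
      N     ∎))
      where open ≤-Reasoning

  CoveredBelow-extend : ∀ {c e m} → e ≤ c → CoveredBelow c →
                        window e m ≡ q ⊎ QP q (window e m) → CoveredBelow (e + m)
  CoveredBelow-extend {c} {e} {m} e≤c covered y i i<e+m with i <? c
  ... | yes i<c = covered i i<c
  ... | no  i≮c = covering y
    where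
    e≤i : e ≤ i
    e≤i = ≤-trans e≤c (≮⇒≥ i≮c)
    covering : window e m ≡ q ⊎ QP q (window e m) → ∃[ j ] Covers j i
    covering (inj₁ y≡q) =
      e , subst (λ n → window e n ≡ q) m≡Q y≡q , e≤i , subst (λ n → i < e + n) m≡Q i<e+m
      where
      m≡Q : m ≡ Q
      m≡Q = trans (sym (length-window e m)) (cong length y≡q)
    covering (inj₂ (_ , covered-y)) with covered-y (i ∸ e) i∸e<m
      where
      i∸e<m : i ∸ e < length (window e m)
      i∸e<m = subst (i ∸ e <_) (trans (m+n∸m≡n e m) (sym (length-window e m)))
                    (∸-monoˡ-< i<e+m e≤i)
    ... | j , (xs , ys , eq , |xs|≡j) , j≤i∸e , i∸e<j+Q =
      e + j , subst (λ n → Occ (e + n)) |xs|≡j (Occ-window e m xs ys eq) ,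
      subst (e + j ≤_) (m+[n∸m]≡n e≤i) (+-monoʳ-≤ e j≤i∸e) ,
      subst₂ _<_ (m+[n∸m]≡n e≤i) (sym (+-assoc e j Q)) (+-monoʳ-< e i∸e<j+Q)

  slice-≡q-or-QP : DecidableEquality B → ∀ {a b} → Occ a → a + Q ≤ b → CoveredWithin b →
                   slice a b ≡ q ⊎ QP q (slice a b)
  slice-≡q-or-QP _≟_ {a} {b} occ-a a+Q≤b covered with ≡-dec _≟_ (slice a b) q
  ... | yes y≡q = inj₁ y≡q
  ... | no  y≢q = inj₂ (y≢q , covered-y)
    where
    relative : ∀ {i j} → Occ j → a ≤ j → j ≤ a + i → a + i < j + Q → j + Q ≤ b →
               ∃[ j' ] (OccAt q (slice a b) j' × j' ≤ i × i < j' + Q)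
    relative {i} {j} occ a≤j j≤a+i a+i<j+Q j+Q≤b =
      j ∸ a , OccAt-slice occ a≤j j+Q≤b ,
      subst (j ∸ a ≤_) (m+n∸m≡n a i) (∸-monoˡ-≤ a j≤a+i) ,
      +-cancelˡ-< a i (j ∸ a + Q) (subst (a + i <_) j+Q≡ a+i<j+Q)
      where
      j+Q≡ : j + Q ≡ a + (j ∸ a + Q)
      j+Q≡ = trans (cong (_+ Q) (sym (m+[n∸m]≡n a≤j))) (+-assoc a (j ∸ a) Q)
    covered-y : ∀ i → i < length (slice a b) →
                ∃[ j ] (OccAt q (slice a b) j × j ≤ i × i < j + Q)
    covered-y i i<length with covered (a + i) a+i<b
      where
      a+i<b : a + i < b
      a+i<b = subst (a + i <_) (m+[n∸m]≡n (≤-trans (m≤m+n a Q) a+Q≤b))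
                (+-monoʳ-< a (subst (i <_) (length-slice a b) i<length))
    ... | j , (occ , j≤a+i , a+i<j+Q) , j+Q≤b with a ≤? j
    ...   | yes a≤j = relative occ a≤j j≤a+i a+i<j+Q j+Q≤b
    ...   | no  a≰j = relative occ-a ≤-refl (m≤m+n a i)
                        (<-≤-trans a+i<j+Q (+-monoˡ-≤ Q (<⇒≤ (≰⇒> a≰j)))) a+Q≤b

record Factorization {A B : Set} (f : A → List B) (w : ℕ → A) (W : ℕ → B) : Set where
  open Window W using (slice)
  field
    cut   : ℕ → ℕ
    cut-0 : cut 0 ≡ 0
    cut-≤ : ∀ k → cut k ≤ cut (suc k)
    k≤cut : ∀ k → k ≤ cut k
    block : ∀ k → f (w k) ≡ slice (cut k) (cut (suc k))

module _ {A B : Set} (f : A → List B) (f≢[] : ∀ a → f a ≢ []) (w : ℕ → A) where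
  open Image f f≢[] w using (img; walk)
  open Window (image f f≢[] w)

  blocksLength : ℕ → ℕ → ℕ
  blocksLength k' zero    = 0
  blocksLength k' (suc k) = length (f (w k')) + blocksLength (suc k') k

  blocksLength-suc : ∀ k' k →
                     blocksLength k' (suc k) ≡ blocksLength k' k + length (f (w (k' + k)))
  blocksLength-suc k' zero    =
    trans (+-identityʳ _) (cong (length ∘ f ∘ w) (sym (+-identityʳ k')))
  blocksLength-suc k' (suc k) = begin
    length (f (w k')) + blocksLength (suc k') (suc k)
      ≡⟨ cong (length (f (w k')) +_) (blocksLength-suc (suc k') k) ⟩
    length (f (w k')) + (blocksLength (suc k') k + length (f (w (suc k' + k))))
      ≡⟨ +-assoc (length (f (w k'))) _ _ ⟨
    blocksLength k' (suc k) + length (f (w (suc k' + k)))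
      ≡⟨ cong (λ n → blocksLength k' (suc k) + length (f (w n))) (+-suc k' k) ⟨
    blocksLength k' (suc k) + length (f (w (k' + suc k))) ∎
    where open ≡-Reasoning

  k≤blocksLength : ∀ k' k → k ≤ blocksLength k' k
  k≤blocksLength k' zero    = z≤n
  k≤blocksLength k' (suc k) =
    +-mono-≤ (≢[]⇒length>0 (f≢[] (w k'))) (k≤blocksLength (suc k') k)

  walk-length : ∀ fuel k u r → walk fuel k u (length u + r) ≡ img fuel (suc k) r
  walk-length fuel k []      r = refl
  walk-length fuel k (_ ∷ u) r = walk-length fuel k u r

  walk-fuel-irrelevant : ∀ fuel fuel' k u t → t < length u → walk fuel k u t ≡ walk fuel' k u t
  walk-fuel-irrelevant fuel fuel' k (_ ∷ u) zero    _         = refl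
  walk-fuel-irrelevant fuel fuel' k (_ ∷ u) (suc t) (s≤s t<u) =
    walk-fuel-irrelevant fuel fuel' k u t t<u

  applyUpTo-walk : ∀ fuel k u → applyUpTo (walk fuel k u) (length u) ≡ u
  applyUpTo-walk fuel k []      = refl
  applyUpTo-walk fuel k (b ∷ u) = cong (b ∷_) (applyUpTo-walk fuel k u)

  img-skip : ∀ k k' fuel r →
             img (suc (k + fuel)) k' (blocksLength k' k + r) ≡ img (suc fuel) (k' + k) r
  img-skip zero    k' fuel r = cong (λ k'' → img (suc fuel) k'' r) (sym (+-identityʳ k'))
  img-skip (suc k) k' fuel r = begin
    walk (suc (k + fuel)) k' (f (w k')) (length (f (w k')) + blocksLength (suc k') k + r)
      ≡⟨ cong (walk (suc (k + fuel)) k' (f (w k'))) (+-assoc (length (f (w k'))) _ r) ⟩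
    walk (suc (k + fuel)) k' (f (w k')) (length (f (w k')) + (blocksLength (suc k') k + r))
      ≡⟨ walk-length (suc (k + fuel)) k' (f (w k')) _ ⟩
    img (suc (k + fuel)) (suc k') (blocksLength (suc k') k + r)
      ≡⟨ img-skip k (suc k') fuel r ⟩
    img (suc fuel) (suc k' + k) r
      ≡⟨ cong (λ k'' → img (suc fuel) k'' r) (+-suc k' k) ⟨
    img (suc fuel) (k' + suc k) r ∎
    where open ≡-Reasoning

  image-block : ∀ k t →
                image f f≢[] w (blocksLength 0 k + t) ≡ walk (blocksLength 0 k + t ∸ k) k (f (w k)) t
  image-block k t = trans (cong (λ n → img (suc n) 0 (blocksLength 0 k + t)) (sym k+fuel≡))
                          (img-skip k 0 (blocksLength 0 k + t ∸ k) t)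
    where
    k+fuel≡ : k + (blocksLength 0 k + t ∸ k) ≡ blocksLength 0 k + t
    k+fuel≡ = m+[n∸m]≡n (≤-trans (k≤blocksLength 0 k) (m≤m+n _ t))

  image-factorization : Factorization f w (image f f≢[] w)
  image-factorization = record
    { cut   = blocksLength 0
    ; cut-0 = refl
    ; cut-≤ = λ k → subst (blocksLength 0 k ≤_) (sym (blocksLength-suc 0 k)) (m≤m+n _ _)
    ; k≤cut = k≤blocksLength 0
    ; block = block
    }
    where
    block : ∀ k → f (w k) ≡ slice (blocksLength 0 k) (blocksLength 0 (suc k))
    block k = begin
      f (w k)
        ≡⟨ applyUpTo-walk 0 k (f (w k)) ⟨
      applyUpTo (walk 0 k (f (w k))) (length (f (w k)))
        ≡⟨ applyUpTo-window _ (blocksLength 0 k) _ (λ t t<u →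
             trans (walk-fuel-irrelevant 0 _ k (f (w k)) t t<u) (sym (image-block k t))) ⟩
      window (blocksLength 0 k) (length (f (w k)))
        ≡⟨ slice-window (blocksLength 0 k) _ ⟨
      slice (blocksLength 0 k) (blocksLength 0 k + length (f (w k)))
        ≡⟨ cong (slice (blocksLength 0 k)) (blocksLength-suc 0 k) ⟨
      slice (blocksLength 0 k) (blocksLength 0 (suc k)) ∎
      where open ≡-Reasoning

module Soundness {A B : Set} (f : A → List B) (W : ℕ → B) (q : List B) where
  open Window W
  open Occurrences W q
  open Automaton f q hiding (Recognized)

  Consistent : ℕ → State → Set
  Consistent N (p , s) = ∃[ c ] (c ≤ N × s ≡ slice c N × Suffix p (slice 0 c) × CoveredBelow c)

  Consistent-initial : Consistent 0 initial
  Consistent-initial = 0 , z≤n , refl , ([] , refl) , λ _ ()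

  Case1-Consistent : ∀ {N₁ N₂ a p₁ s₁ p₂ s₂} → N₁ ≤ N₂ → f a ≡ slice N₁ N₂ →
                     Consistent N₁ (p₁ , s₁) → Case1 (p₁ , s₁) a (p₂ , s₂) → Consistent N₂ (p₂ , s₂)
  Case1-Consistent N₁≤N₂ fa≡ (c , c≤N₁ , s₁≡ , p₁-suffix , covered) (_ , _ , s₂≡ , p₂-suffix , _) =
    c , ≤-trans c≤N₁ N₁≤N₂ , trans s₂≡ (trans (cong₂ _++_ s₁≡ fa≡) (slice-++ c≤N₁ N₁≤N₂)) ,
    Suffix-trans p₂-suffix p₁-suffix , covered

  Case2-Consistent : ∀ {N₁ N₂ a p₁ s₁ p₂ s₂} → N₁ ≤ N₂ → f a ≡ slice N₁ N₂ →
                     Consistent N₁ (p₁ , s₁) → Case2 (p₁ , s₁) a (p₂ , s₂) → Consistent N₂ (p₂ , s₂)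
  Case2-Consistent {N₁} {N₂} {a} {s₁ = s₁} {s₂ = s₂} N₁≤N₂ fa≡ (c , c≤N₁ , s₁≡ , p₁-suffix , covered)
                   (_ , x , y , x-suffix , eq , y≡q-or-QP , p₂-suffix , _)
    with Suffix-slice⁻ (Suffix-trans x-suffix p₁-suffix) z≤n
  ... | e , _ , e≤c , refl =
    let c'≤N₂ , y≡window , s₂≡ = slice-++⁻ y s₂ y++s₂ (≤-trans e≤c (≤-trans c≤N₁ N₁≤N₂)) in
    e + length y , c'≤N₂ , s₂≡ , Suffix-trans p₂-suffix (y-suffix y≡window) ,
    CoveredBelow-extend e≤c covered (subst (λ y' → y' ≡ q ⊎ QP q y') y≡window y≡q-or-QP)
    where
    y++s₂ : y ++ s₂ ≡ slice e N₂
    y++s₂ = begin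
      y ++ s₂                                ≡⟨ eq ⟨
      slice e c ++ s₁ ++ f a                 ≡⟨ cong (slice e c ++_) (cong₂ _++_ s₁≡ fa≡) ⟩
      slice e c ++ slice c N₁ ++ slice N₁ N₂ ≡⟨ cong (slice e c ++_) (slice-++ c≤N₁ N₁≤N₂) ⟩
      slice e c ++ slice c N₂                ≡⟨ slice-++ e≤c (≤-trans c≤N₁ N₁≤N₂) ⟩
      slice e N₂                             ∎
      where open ≡-Reasoning
    y-suffix : y ≡ window e (length y) → Suffix y (slice 0 (e + length y))
    y-suffix y≡window = subst (λ y' → Suffix y' (slice 0 (e + length y)))
                              (trans (slice-window e (length y)) (sym y≡window))
                              (Suffix-slice z≤n (m≤m+n e _))

  Trans-Consistent : ∀ {N₁ N₂ a st st'} → N₁ ≤ N₂ → f a ≡ slice N₁ N₂ →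
                     Consistent N₁ st → Trans st a st' → Consistent N₂ st'
  Trans-Consistent N₁≤N₂ fa≡ consistent (_ , _ , inj₁ case1) =
    Case1-Consistent N₁≤N₂ fa≡ consistent case1
  Trans-Consistent N₁≤N₂ fa≡ consistent (_ , _ , inj₂ case2) =
    Case2-Consistent N₁≤N₂ fa≡ consistent case2

  module _ {w : ℕ → A} (F : Factorization f w W) where
    open Factorization F

    Run-Consistent : ∀ m k {st} → Consistent (cut k) st → Run st (Window.window w k m) →
                     ∃[ st' ] (Consistent (cut (k + m)) st' × InQ st')
    Run-Consistent zero k {st} consistent inQ =
      st , subst (λ n → Consistent (cut n) st) (sym (+-identityʳ k)) consistent , inQ
    Run-Consistent (suc m) k consistent (st' , step , run)
      with Run-Consistent m (suc k) (Trans-Consistent (cut-≤ k) (block k) consistent step) run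
    ... | st'' , consistent'' , inQ =
      st'' , subst (λ n → Consistent (cut n) st'') (sym (+-suc k m)) consistent'' , inQ

    recognized⇒QPInf : (∀ n → Recognized f q (prefix n w)) → QPInf q W
    recognized⇒QPInf recognized i
      with Run-Consistent (i + Q) 0
             (subst (λ n → Consistent n initial) (sym cut-0) Consistent-initial)
             (subst (Run initial) (Window.map-upTo≡window w 0 (i + Q)) (recognized (i + Q)))
    ... | (p , s) , (c , c≤N , s≡ , _ , covered) , inQ =
      let j , occ , j≤i , i<j+Q = covered i i<c in j , Occ⇒OccAtInf occ , j≤i , i<j+Q
      where
      N : ℕ
      N = cut (i + Q)
      N∸c<Q : N ∸ c < Q
      N∸c<Q = begin-strict
        N ∸ c               ≡⟨ trans (sym (length-slice c N)) (cong length (sym s≡)) ⟩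
        length s            ≤⟨ m≤n+m (length s) (length p) ⟩
        length p + length s ≡⟨ length-++ p ⟨
        length (p ++ s)     <⟨ ProperPrefix⇒length< inQ ⟩
        Q                   ∎
        where open ≤-Reasoning
      i<c : i < c
      i<c = +-cancelʳ-< Q i c (begin-strict
        i + Q       ≤⟨ k≤cut (i + Q) ⟩
        N           ≤⟨ m≤n+m∸n N c ⟩
        c + (N ∸ c) <⟨ +-monoʳ-< c N∸c<Q ⟩
        c + Q       ∎)
        where open ≤-Reasoning

module Completeness {A B : Set} (_≟_ : DecidableEquality B) (f : A → List B) (W : ℕ → B)
                    (q : List B) (q≢[] : q ≢ []) where
  open Window W
  open Occurrences W q
  open Automaton f q hiding (Recognized)

  record Canonical (N c d : ℕ) : Set where
    field
      c≤N          : c ≤ N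
      d≤c          : d ≤ c
      properPrefix : ProperPrefix (slice d N) q
      leftmost     : ∀ {e} → ProperPrefix (slice e N) q → d ≤ e
      lastOcc      : ∀ {j} → Occ j → j + Q ≤ N → j + Q ≤ c

  LongestSuffix-canonical : ∀ {N c d a} → Canonical N c d → a ≤ d →
                            LongestSuffix (slice d c) (slice a c) (slice c N)
  LongestSuffix-canonical {N} {c} {d} {a} canonical a≤d =
    Suffix-slice a≤d d≤c ,
    subst (λ u → ProperPrefix u q) (sym (slice-++ d≤c c≤N)) properPrefix ,
    longest
    where
    open Canonical canonical
    longest : ∀ p' → Suffix p' (slice a c) → ProperPrefix (p' ++ slice c N) q →
              length p' ≤ length (slice d c)
    longest p' p'-suffix pp with Suffix-slice⁻ p'-suffix (≤-trans a≤d d≤c)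
    ... | e , _ , e≤c , refl =
      length-slice-antitone (leftmost (subst (λ u → ProperPrefix u q) (slice-++ e≤c c≤N) pp))

  Case1-canonical : ∀ {N₁ N₂ c d₁ d₂ a} → N₁ ≤ N₂ → f a ≡ slice N₁ N₂ →
                    Canonical N₁ c d₁ → Canonical N₂ c d₂ →
                    Case1 (slice d₁ c , slice c N₁) a (slice d₂ c , slice c N₂)
  Case1-canonical {N₁} {N₂} {c} {d₁} {d₂} {a} N₁≤N₂ fa≡ canonical₁ canonical₂ =
    no-occurrence , short , sym tail≡ ,
    subst (LongestSuffix (slice d₂ c) (slice d₁ c)) (sym tail≡)
          (LongestSuffix-canonical canonical₂ d₁≤d₂)
    where
    module C₁ = Canonical canonical₁
    module C₂ = Canonical canonical₂
    tail≡ : slice c N₁ ++ f a ≡ slice c N₂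
    tail≡ = trans (cong (slice c N₁ ++_) fa≡) (slice-++ C₁.c≤N N₁≤N₂)
    whole≡ : slice d₁ c ++ slice c N₁ ++ f a ≡ slice d₁ N₂
    whole≡ = trans (cong (slice d₁ c ++_) tail≡) (slice-++ C₁.d≤c (≤-trans C₁.c≤N N₁≤N₂))
    no-occurrence : ¬ Occurs q (slice d₁ c ++ slice c N₁ ++ f a)
    no-occurrence occurs
      with Occurs-slice⁻ (subst (Occurs q) whole≡ occurs) (≤-trans (≤-trans C₁.d≤c C₁.c≤N) N₁≤N₂)
    ... | j , occ , d₁≤j , j+Q≤N₂ =
      ProperPrefix-slice⇒¬Occ C₁.properPrefix occ d₁≤j (≤-trans (C₂.lastOcc occ j+Q≤N₂) C₁.c≤N)
    short : length (slice c N₁ ++ f a) < Q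
    short = begin-strict
      length (slice c N₁ ++ f a) ≡⟨ cong length tail≡ ⟩
      length (slice c N₂)        ≤⟨ length-slice-antitone C₂.d≤c ⟩
      length (slice d₂ N₂)       <⟨ ProperPrefix⇒length< C₂.properPrefix ⟩
      Q                          ∎
      where open ≤-Reasoning
    d₁≤d₂ : d₁ ≤ d₂
    d₁≤d₂ = C₁.leftmost (ProperPrefix-++⁻ (subst (λ u → ProperPrefix u q)
              (sym (slice-++ (≤-trans C₂.d≤c C₁.c≤N) N₁≤N₂)) C₂.properPrefix))

  Case2-canonical : ∀ {N₁ N₂ c₁ c₂ d₁ d₂ a} → N₁ ≤ N₂ → f a ≡ slice N₁ N₂ →
                    Canonical N₁ c₁ d₁ → Canonical N₂ c₂ d₂ → c₁ < c₂ → CoveredWithin c₂ →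
                    Case2 (slice d₁ c₁ , slice c₁ N₁) a (slice d₂ c₂ , slice c₂ N₂)
  Case2-canonical {N₁} {N₂} {c₁} {c₂} {d₁} {d₂} {a} N₁≤N₂ fa≡ canonical₁ canonical₂ c₁<c₂ covered
    with covered c₁ c₁<c₂
  ... | j , (occ , j≤c₁ , c₁<j+Q) , j+Q≤c₂ =
    subst (Occurs q) (sym whole≡) (Occurs-slice occ d₁≤j j+Q≤N₂) ,
    slice j c₁ , slice j c₂ , Suffix-slice d₁≤j j≤c₁ ,
    trans (cong (slice j c₁ ++_) tail≡) (trans (slice-++ j≤c₁ c₁≤N₂) (sym (slice-++ j≤c₂ C₂.c≤N))) ,
    slice-≡q-or-QP _≟_ occ j+Q≤c₂ covered ,
    LongestSuffix-canonical canonical₂ j≤d₂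
    where
    module C₁ = Canonical canonical₁
    module C₂ = Canonical canonical₂
    c₁≤N₂ : c₁ ≤ N₂
    c₁≤N₂ = ≤-trans C₁.c≤N N₁≤N₂
    j≤c₂ : j ≤ c₂
    j≤c₂ = ≤-trans (m≤m+n j Q) j+Q≤c₂
    j+Q≤N₂ : j + Q ≤ N₂
    j+Q≤N₂ = ≤-trans j+Q≤c₂ C₂.c≤N
    tail≡ : slice c₁ N₁ ++ f a ≡ slice c₁ N₂
    tail≡ = trans (cong (slice c₁ N₁ ++_) fa≡) (slice-++ C₁.c≤N N₁≤N₂)
    whole≡ : slice d₁ c₁ ++ slice c₁ N₁ ++ f a ≡ slice d₁ N₂
    whole≡ = trans (cong (slice d₁ c₁ ++_) tail≡) (slice-++ C₁.d≤c c₁≤N₂)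
    N₁<j+Q : N₁ < j + Q
    N₁<j+Q with j + Q ≤? N₁
    ... | yes j+Q≤N₁ = ⊥-elim (<⇒≱ c₁<j+Q (C₁.lastOcc occ j+Q≤N₁))
    ... | no  j+Q≰N₁ = ≰⇒> j+Q≰N₁
    d₁≤j : d₁ ≤ j
    d₁≤j = C₁.leftmost (Occ⇒ProperPrefix-slice occ (≤-trans j≤c₁ C₁.c≤N) N₁<j+Q)
    j≤d₂ : j ≤ d₂
    j≤d₂ with j ≤? d₂
    ... | yes j≤d₂ = j≤d₂
    ... | no  j≰d₂ =
      ⊥-elim (ProperPrefix-slice⇒¬Occ C₂.properPrefix occ (<⇒≤ (≰⇒> j≰d₂)) j+Q≤N₂)

  module _ (qp : QPInf q W) where

    EndsOcc : ℕ → Set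
    EndsOcc e = Q ≤ e × Occ (e ∸ Q)

    endsOcc? : Decidable EndsOcc
    endsOcc? e = (Q ≤? e) ×-dec ≡-dec _≟_ (window (e ∸ Q) Q) q

    lastEnd : ℕ → ℕ
    lastEnd = lastUpTo endsOcc?

    Occ⇒≤lastEnd : ∀ {j N} → Occ j → j + Q ≤ N → j + Q ≤ lastEnd N
    Occ⇒≤lastEnd {j} occ j+Q≤N =
      lastUpTo-greatest endsOcc? j+Q≤N (m≤n+m Q j , subst Occ (sym (m+n∸n≡m j Q)) occ)

    lastEnd-covered : ∀ N → CoveredWithin (lastEnd N)
    lastEnd-covered N i i<c with qp i
    ... | j , occ , j≤i , i<j+Q with j + Q ≤? N
    ...   | yes j+Q≤N =
      j , (OccAtInf⇒Occ occ , j≤i , i<j+Q) , Occ⇒≤lastEnd (OccAtInf⇒Occ occ) j+Q≤N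
    ...   | no  j+Q≰N with lastUpTo-zero-or-satisfies endsOcc? N
    ...     | inj₁ c≡0 = ⊥-elim (n≮0 (subst (i <_) c≡0 i<c))
    ...     | inj₂ (Q≤c , occ-c) with lastEnd N ∸ Q ≤? i
    ...       | yes c∸Q≤i =
      lastEnd N ∸ Q , (occ-c , c∸Q≤i , subst (i <_) (sym (m∸n+n≡m Q≤c)) i<c) ,
      ≤-reflexive (m∸n+n≡m Q≤c)
    ...       | no  c∸Q≰i = ⊥-elim (j+Q≰N (<⇒≤ (begin-strict
      j + Q               ≤⟨ +-monoˡ-≤ Q j≤i ⟩
      i + Q               <⟨ +-monoˡ-< Q (≰⇒> c∸Q≰i) ⟩
      lastEnd N ∸ Q + Q   ≡⟨ m∸n+n≡m Q≤c ⟩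
      lastEnd N           ≤⟨ lastUpTo-≤ endsOcc? N ⟩
      N                   ∎)))
      where open ≤-Reasoning

    start : ℕ → ℕ
    start N = firstUpTo (λ e → properPrefix? _≟_ (slice e N) q) (lastEnd N)

    ProperPrefix-slice-below-lastEnd : ∀ N → ∃[ e ] (e ≤ lastEnd N × ProperPrefix (slice e N) q)
    ProperPrefix-slice-below-lastEnd N with m≤n⇒m<n∨m≡n (lastUpTo-≤ endsOcc? N)
    ... | inj₂ c≡N =
      lastEnd N , ≤-refl , subst (λ u → ProperPrefix u q) (sym slice-c-N≡[]) (q , q≢[] , refl)
      where
      slice-c-N≡[] : slice (lastEnd N) N ≡ []
      slice-c-N≡[] = trans (cong (slice (lastEnd N)) (sym c≡N)) (slice-empty (lastEnd N))
    ... | inj₁ c<N with qp (lastEnd N)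
    ...   | j , occ , j≤c , c<j+Q with j + Q ≤? N
    ...     | yes j+Q≤N = ⊥-elim (<⇒≱ c<j+Q (Occ⇒≤lastEnd (OccAtInf⇒Occ occ) j+Q≤N))
    ...     | no  j+Q≰N =
      j , j≤c , Occ⇒ProperPrefix-slice (OccAtInf⇒Occ occ) (≤-trans j≤c (<⇒≤ c<N)) (≰⇒> j+Q≰N)

    canonical : ∀ N → Canonical N (lastEnd N) (start N)
    canonical N = record
      { c≤N          = lastUpTo-≤ endsOcc? N
      ; d≤c          = firstUpTo-≤ pp? (lastEnd N)
      ; properPrefix = let _ , e≤c , pp = ProperPrefix-slice-below-lastEnd N
                       in proj₁ (firstUpTo-least pp? e≤c pp)
      ; leftmost     = leftmost
      ; lastOcc      = Occ⇒≤lastEnd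
      }
      where
      pp? : Decidable (λ e → ProperPrefix (slice e N) q)
      pp? e = properPrefix? _≟_ (slice e N) q
      leftmost : ∀ {e} → ProperPrefix (slice e N) q → start N ≤ e
      leftmost {e} pp with e ≤? lastEnd N
      ... | yes e≤c = proj₂ (firstUpTo-least pp? e≤c pp)
      ... | no  e≰c = ≤-trans (firstUpTo-≤ pp? (lastEnd N)) (<⇒≤ (≰⇒> e≰c))

    state : ℕ → State
    state N = slice (start N) (lastEnd N) , slice (lastEnd N) N

    InQ-state : ∀ N → InQ (state N)
    InQ-state N = subst (λ u → ProperPrefix u q) (sym (slice-++ d≤c c≤N)) properPrefix
      where open Canonical (canonical N)

    Trans-state : ∀ {N₁ N₂ a} → N₁ ≤ N₂ → f a ≡ slice N₁ N₂ → Trans (state N₁) a (state N₂)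
    Trans-state {N₁} {N₂} {a} N₁≤N₂ fa≡ = InQ-state N₁ , InQ-state N₂ , cases
      where
      cases : Case1 (state N₁) a (state N₂) ⊎ Case2 (state N₁) a (state N₂)
      cases with m≤n⇒m<n∨m≡n (lastUpTo-mono endsOcc? N₁≤N₂)
      ... | inj₁ c₁<c₂ =
        inj₂ (Case2-canonical N₁≤N₂ fa≡ (canonical N₁) (canonical N₂) c₁<c₂ (lastEnd-covered N₂))
      ... | inj₂ c₁≡c₂ =
        inj₁ (subst (λ c → Case1 (state N₁) a (slice (start N₂) c , slice c N₂)) c₁≡c₂
               (Case1-canonical N₁≤N₂ fa≡ (canonical N₁)
                  (subst (λ c → Canonical N₂ c (start N₂)) (sym c₁≡c₂) (canonical N₂))))

    module _ {w : ℕ → A} (F : Factorization f w W) where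
      open Factorization F

      Run-state : ∀ m k → Run (state (cut k)) (Window.window w k m)
      Run-state zero    k = InQ-state (cut k)
      Run-state (suc m) k =
        state (cut (suc k)) , Trans-state (cut-≤ k) (block k) , Run-state m (suc k)

      QPInf⇒recognized : ∀ n → Recognized f q (prefix n w)
      QPInf⇒recognized n =
        subst₂ Run (cong state cut-0) (sym (Window.map-upTo≡window w 0 n)) (Run-state n 0)

lemma5p4 : ∀ {k l : ℕ} (f : Fin k → List (Fin l)) (ne : ∀ a → f a ≢ [])
           (q : List (Fin l)) → q ≢ [] → (w : ℕ → Fin k) →
           QPInf q (image f ne w) ⇔ (∀ n → Recognized f q (prefix n w))
lemma5p4 f ne q q≢[] w =
  mk⇔ (λ qp → Completeness.QPInf⇒recognized Fin._≟_ f (image f ne w) q q≢[] qp F)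
      (Soundness.recognized⇒QPInf f (image f ne w) q F)
  where
  F : Factorization f w (image f ne w)
  F = image-factorization f ne w
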